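{- Let $s=(\mathbb{B},P,E)$ be an EXAM state and $a$ an address defined in $\mathbb{B}$. Then $a$ is defined in $\mathrm{rb}(s)$, and, unless $\mathbb{B}|_a$ is a named hole, $\mathrm{rb}(s)|_a$ starts with the same constructor as $\mathbb{B}|_a$.
   Context: Pre-terms $t ::= x\mid\lambda x.t\mid t\,t$; $t\{x:=u\}$ capture-avoiding substitution. Stacks $S ::= \epsilon\mid t:S$. Environments $E ::= \epsilon\mid[x\leftarrow t]:E$. Named multi-contexts $\mathbb{C} ::= x\mid\langle\cdot\rangle_\alpha\mid\lambda x.\mathbb{C}\mid\mathbb{C}\,\mathbb{C}$; $\mathbb{C}\{\alpha\leftarrow\mathbb{C}'\}$ capture-allowing replacement of $\langle\cdot\rangle_\alpha$ by $\mathbb{C}'$. Approximants $\mathbb{B} ::= \langle\cdot\rangle_\alpha\mid\mathbb{R}\mid\lambda x.\mathbb{B}$, $\mathbb{R} ::= x\mid\mathbb{R}\,\mathbb{B}$. Jobs $(t,S)_\alpha$. An EXAM state is a triple $(\mathbb{B},P,E)$ with $\mathbb{B}$ an approximant, $E$ an environment and $P$ a pool whose support $\mathrm{supp}(P)$ is a finite set of jobs with pairwise distinct names. Read-back: $t\downarrow\epsilon:=t$, $t\downarrow([x\leftarrow u]:E):=(t\{x:=u\})\downarrow E$; stacks pointwise; $\langle t\mid\epsilon\rangle:=t$, $\langle t\mid u:S\rangle:=\langle t\,u\mid S\rangle$; $(t,S)_\alpha\downarrow E:=(t\downarrow E,S\downarrow E)_\alpha$, lifted to sets; $\mathrm{rb}((t,S)_\alpha):=\langle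 t\mid S\rangle$; $\mathbb{C}_X:=\mathbb{C}\{\alpha_1\leftarrow\mathrm{rb}(j_{\alpha_1})\}\cdots\{\alpha_n\leftarrow\mathrm{rb}(j_{\alpha_n})\}$ for $X=\{j_{\alpha_1},\dots,j_{\alpha_n}\}$; $\mathrm{rb}((\mathbb{B},P,E)):=\mathbb{B}_{\mathrm{supp}(P)\downarrow E}$. Addresses are strings over $\{l,r,\lambda\}$. The sub-term at an address is the partial function: $t|_\epsilon:=t$; $(t\,u)|_{l:a}:=t|_a$; $(t\,u)|_{r:a}:=u|_a$; $(\lambda x.t)|_{\lambda:a}:=t|_a$; undefined in all other cases; likewise for multi-contexts. An address $a$ is defined in $t$ (resp. $\mathbb{C}$) if $t|_a$ (resp. $\mathbb{C}|_a$) is defined. -}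

module Defs where

open import Data.Nat using (ℕ; suc; _⊔_; _≡ᵇ_)
open import Data.Bool using (Bool; true; false; if_then_else_; _∨_; not)
open import Data.List using (List; []; _∷_; _++_; map; foldr; concatMap)
open import Data.Bool.ListAction using (any)
open import Relation.Binary.PropositionalEquality using (_≡_)
open import Relation.Nullary.Decidable using (does)
open import Data.List.Relation.Unary.Unique.Propositional using (Unique)
open import Data.Maybe using (Maybe; just; nothing)
open import Data.Product using (_×_; _,_)

Var : Set
Var = ℕ

Name : Set
Name = ℕ

data Term : Set where
  var : Var → Term
  lam : Var → Term → Term
  app : Term → Term → Term

filterᵇ : {A : Set} → (A → Bool) → List A → List A
filterᵇ p [] = []
filterᵇ p (x ∷ xs) = if p x then x ∷ filterᵇ p xs else filterᵇ p xs

fv : Term → List Var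
fv (var x)   = x ∷ []
fv (lam x t) = filterᵇ (λ y → not (y ≡ᵇ x)) (fv t)
fv (app t u) = fv t ++ fv u

vars : Term → List Var
vars (var x)   = x ∷ []
vars (lam x t) = x ∷ vars t
vars (app t u) = vars t ++ vars u

maxL : List ℕ → ℕ
maxL = foldr _⊔_ 0

_∈ᵇ_ : ℕ → List ℕ → Bool
x ∈ᵇ xs = any (x ≡ᵇ_) xs

-- Simultaneous capture-avoiding substitution (structural on the term).
-- Under a binder y the bound name is kept when no capture can occur and
-- is otherwise renamed to a fresh name.
Sub : Set
Sub = Var → Term

extend : Sub → Var → Term → Sub
extend σ y u w = if w ≡ᵇ y then u else σ w

substS : Sub → Term → Term
substS σ (var x)   = σ x
substS σ (app t u) = app (substS σ t) (substS σ u)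
substS σ (lam y t) =
  let others  = filterᵇ (λ w → not (w ≡ᵇ y)) (fv t)
      images  = concatMap (λ w → fv (σ w)) others
      clash   = y ∈ᵇ images
      z       = if clash then suc (maxL (images ++ vars t)) else y
  in lam z (substS (extend σ y (var z)) t)

_[_≔_] : Term → Var → Term → Term
t [ x ≔ u ] = substS (extend var x u) t

Stack : Set
Stack = List Term

Env : Set
Env = List (Var × Term)

record Job : Set where
  constructor job
  field
    tm    : Term
    stk   : Stack
    jname : Name
open Job public

_↓_ : Term → Env → Term
t ↓ []            = t
t ↓ ((x , u) ∷ E) = (t [ x ≔ u ]) ↓ E

_↓S_ : Stack → Env → Stack
S ↓S E = map (_↓ E) S

plug : Term → Stack → Term
plug t []      = t
plug t (u ∷ S) = plug (app t u) S

_↓J_ : Job → Env → Job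
job t S α ↓J E = job (t ↓ E) (S ↓S E) α

rbJ : Job → Term
rbJ (job t S α) = plug t S

data Ctx : Set where
  cvar  : Var → Ctx
  hole  : Name → Ctx
  clam  : Var → Ctx → Ctx
  capp  : Ctx → Ctx → Ctx

toCtx : Term → Ctx
toCtx (var x)   = cvar x
toCtx (lam x t) = clam x (toCtx t)
toCtx (app t u) = capp (toCtx t) (toCtx u)

-- C{α ← C'}  (capture-allowing)
replace : Ctx → Name → Ctx → Ctx
replace (cvar x)   α C' = cvar x
replace (hole β)   α C' = if β ≡ᵇ α then C' else hole β
replace (clam x C) α C' = clam x (replace C α C')
replace (capp C D) α C' = capp (replace C α C') (replace D α C')

-- C_X  for a (duplicate-name-free) list of jobs X
fillJobs : Ctx → List Job → Ctx
fillJobs C []       = C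
fillJobs C (j ∷ X)  = fillJobs (replace C (jname j) (toCtx (rbJ j))) X

mutual
  data IsB : Ctx → Set where
    b-hole : ∀ α → IsB (hole α)
    b-R    : ∀ {C} → IsR C → IsB C
    b-lam  : ∀ x {C} → IsB C → IsB (clam x C)

  data IsR : Ctx → Set where
    r-var : ∀ x → IsR (cvar x)
    r-app : ∀ {C D} → IsR C → IsB D → IsR (capp C D)

-- EXAM states: the pool is represented by its support, a list of jobs
-- with pairwise distinct names.

record State : Set where
  constructor state
  field
    apx      : Ctx
    apx-ok   : IsB apx
    pool     : List Job
    pool-ok  : Unique (map jname pool)
    env      : Env
open State public

rb : State → Ctx
rb s = fillJobs (apx s) (map (_↓J env s) (pool s))

data Dir : Set where
  l r λ' : Dir

Addr : Set
Addr = List Dir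

_at_ : Ctx → Addr → Maybe Ctx
C          at []        = just C
capp C D   at (l ∷ a)   = C at a
capp C D   at (r ∷ a)   = D at a
clam x C   at (λ' ∷ a)  = C at a
_          at (_ ∷ _)   = nothing

data Con : Set where
  k-var k-hole k-lam k-app : Con

head : Ctx → Con
head (cvar _)   = k-var
head (hole _)   = k-hole
head (clam _ _) = k-lam
head (capp _ _) = k-app

IsHole : Ctx → Set
IsHole C = head C ≡ k-hole

module Submission where

open import Defs
open import Data.Maybe using (just)
open import Data.Product using (Σ; _×_; _,_)
open import Data.List using (List; []; _∷_; map)
open import Data.Empty using (⊥-elim)
open import Function using (_∘_)
open import Relation.Binary.PropositionalEquality using (_≡_; refl; sym; trans)
open import Relation.Nullary using (¬_)

replace-at : ∀ C a D α C' → C at a ≡ just D → replace C α C' at a ≡ just (replace D α C')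
replace-at C          []       D α C' refl = refl
replace-at (capp C E) (l ∷ a)  D α C' p    = replace-at C a D α C' p
replace-at (capp C E) (r ∷ a)  D α C' p    = replace-at E a D α C' p
replace-at (clam x C) (λ' ∷ a) D α C' p    = replace-at C a D α C' p
replace-at (capp C E) (λ' ∷ a) D α C' ()
replace-at (clam x C) (l ∷ a)  D α C' ()
replace-at (clam x C) (r ∷ a)  D α C' ()
replace-at (cvar x)   (_ ∷ a)  D α C' ()
replace-at (hole β)   (_ ∷ a)  D α C' ()

fillJobs-at : ∀ X C a D → C at a ≡ just D → fillJobs C X at a ≡ just (fillJobs D X)
fillJobs-at []      C a D p = p
fillJobs-at (j ∷ X) C a D p =
  fillJobs-at X _ a _ (replace-at C a D (jname j) (toCtx (rbJ j)) p)

head-replace : ∀ D α C' → ¬ IsHole D → head (replace D α C') ≡ head D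
head-replace (cvar x)   α C' _  = refl
head-replace (hole β)   α C' nh = ⊥-elim (nh refl)
head-replace (clam x D) α C' _  = refl
head-replace (capp D E) α C' _  = refl

head-fillJobs : ∀ X D → ¬ IsHole D → head (fillJobs D X) ≡ head D
head-fillJobs []      D nh = refl
head-fillJobs (j ∷ X) D nh =
  trans (head-fillJobs X _ (nh ∘ trans (sym replaced))) replaced
  where
  replaced : head (replace D (jname j) (toCtx (rbJ j))) ≡ head D
  replaced = head-replace D (jname j) (toCtx (rbJ j)) nh

lemma7 : (s : State) (a : Addr) (C : Ctx) → apx s at a ≡ just C →
         Σ Ctx (λ D → (rb s at a ≡ just D) × (¬ IsHole C → head D ≡ head C))
lemma7 s a C p = fillJobs C jobs , fillJobs-at jobs (apx s) a C p , head-fillJobs jobs C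
  where
  jobs : List Job
  jobs = map (_↓J env s) (pool s)
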